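{- Let $\Phi=(\Phi^+,\Phi^-)$ be a regular integral structure type, let $\mathscr{V}$ be the operator on regular integral structure types defined below, and let $\vartheta$ be the operator on $\mathbb{Z}[\![z]\!]$ given by $\vartheta\left(\sum_{n\ge0}a_nz^n\right)=-\sum_{n\ge1}a_{n+1}z^n$. Then $(\mathscr{V}\Phi)(z)=\vartheta(\Phi(z))\in\mathbb{Z}[\![z]\!]$.
   Context: $\mathfrak{Fin}_0$ is the category of finite sets and bijections. A structure type is a functor $F:\mathfrak{Fin}_0\to\mathfrak{Fin}$; $F_n=|F(S)|$ for $|S|=n$, and its generating series is $F(z)=\sum_n \frac{F_n}{n!}z^n$. $F$ has degree $n$ if $F(S)=\varnothing$ whenever $|S|\ne n$; every $F$ is the sum of its degree-$n$ components $F_{(n)}$ (with $F_{(n)}(S)=F(S)$ if $|S|=n$, empty otherwise). For $|S|=n$ the symmetric group $\mathcal{S}_n$ acts on $F(S)$ by relabeling; $F$ is regular if every element of every $F(S)$ has trivial stabilizer. An integral structure type is a pair $\Phi=(\Phi^+,\Phi^-)$ of structure types, with generating series $\Phi(z)=\Phi^+(z)-\Phi^-(z)$, sum componentwise; it is regular if $\Phi^+$ and $\Phi^-$ are regular. For a regular structure type $F$ the operator $\mathscr{X}$ is defined by $\mathscr{X}F(S)=F_{(n)}(S\sqcup\{\star\})/\mathbb{Z}_n$ for $|S|=n-1$, where $\mathbb{Z}_n$ is the subgroup of cyclic permutations of the symmetric group on the $n$-element set $S\sqcup\{\star\}$ (for regular $F$ this is again a structure type; e.g. $\mathscr{X}Z^n\cong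 Z^{n-1}$ where $Z^n$ is the structure of linear orderings of an $n$-element set). For a regular integral structure type $\Phi_{(k)}=(\Phi^+_{(k)},\Phi^-_{(k)})$ of degree $k$, $\mathscr{V}\Phi_{(k)}=(\mathbf{0},\mathbf{0})$ for $k=0,1$ and $\mathscr{V}\Phi_{(k)}=(\mathscr{X}\Phi^-_{(k)},\mathscr{X}\Phi^+_{(k)})$ otherwise; $\mathscr{V}$ is extended additively over the decomposition of $\Phi$ into degree components. Here $\mathbf{0}$ is the structure type with $\mathbf{0}(S)=\varnothing$ for all $S$. -}

module Defs where

open import Data.Nat using (ℕ; zero; suc; _!)
open import Data.Nat.Properties using (_!≢0)
open import Data.Fin using (Fin; zero; suc; _≤_; _≤?_)
open import Data.Fin.Properties using (all?)
open import Data.Fin.Permutation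
  using (Permutation′; _⟨$⟩ʳ_; _∘ₚ_; transpose; lift₀; _≈_)
  renaming (id to idₚ)
open import Data.List using (List; length; filter; allFin)
open import Data.Integer using (+_)
open import Data.Rational using (ℚ; _/_; _-_; -_; 0ℚ)
open import Relation.Binary.PropositionalEquality using (_≡_)
open import Relation.Nullary using (Dec)
open import Data.Product using (_×_)
open import Data.Fin using (toℕ)

-- We use the skeleton of 𝔉𝔦𝔫₀: the n-element set is Fin n and the
-- morphisms are the permutations of Fin n.  A finite set F(S) with
-- |S| = n is represented by Fin (card n), so F_n = card n.

record StructureType : Set where
  field
    card   : ℕ → ℕ
    act    : ∀ {n} → Permutation′ n → Fin (card n) → Fin (card n)
    act-id : ∀ {n} (x : Fin (card n)) → act (idₚ {n}) x ≡ x
    -- σ ∘ₚ τ means "first σ, then τ"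
    act-∘  : ∀ {n} (σ τ : Permutation′ n) (x : Fin (card n)) →
             act (σ ∘ₚ τ) x ≡ act τ (act σ x)
    act-cong : ∀ {n} (σ τ : Permutation′ n) → σ ≈ τ →
               (x : Fin (card n)) → act σ x ≡ act τ x

open StructureType public

Regular : StructureType → Set
Regular F = ∀ n (σ : Permutation′ n) (x : Fin (card F n)) →
            act F σ x ≡ x → σ ≈ idₚ

-- Coefficient of z^n in the generating series F(z) = Σ F_n / n! z^n.
gs : StructureType → ℕ → ℚ
gs F n = _/_ (+ card F n) (n !) {{n !≢0}}

record IntegralStructureType : Set where
  field
    pos : StructureType
    neg : StructureType

open IntegralStructureType public

RegularI : IntegralStructureType → Set
RegularI Φ = Regular (pos Φ) × Regular (neg Φ)

gsI : IntegralStructureType → ℕ → ℚ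
gsI Φ n = gs (pos Φ) n - gs (neg Φ) n

-- The cyclic subgroup ℤ_n of the symmetric group on Fin n: generated by
-- the n-cycle  cyc n = (0 1)(1 2)…(n-2 n-1)  (built recursively).

cyc : ∀ n → Permutation′ n
cyc zero          = idₚ
cyc (suc zero)    = idₚ
cyc (suc (suc k)) = lift₀ (cyc (suc k)) ∘ₚ transpose zero (suc zero)

_^ₚ_ : ∀ {n} → Permutation′ n → ℕ → Permutation′ n
σ ^ₚ zero  = idₚ
σ ^ₚ suc j = σ ∘ₚ (σ ^ₚ j)

rot : ∀ n → Fin n → Permutation′ n
rot n j = cyc n ^ₚ toℕ j

-- For |S| = m we take S ⊔ {⋆} = Fin (suc m).  𝒳F(S) = F(S ⊔ {⋆}) / ℤ_{m+1}
-- is represented by the set of canonical representatives of the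
-- ℤ_{m+1}-orbits: elements x that are ≤ every element of their orbit.

IsOrbitRep : (F : StructureType) (n : ℕ) → Fin (card F n) → Set
IsOrbitRep F n x = ∀ (j : Fin n) → x ≤ act F (rot n j) x

isOrbitRep? : (F : StructureType) (n : ℕ) (x : Fin (card F n)) →
              Dec (IsOrbitRep F n x)
isOrbitRep? F n x = all? (λ j → x ≤? act F (rot n j) x)

orbitCount : StructureType → ℕ → ℕ
orbitCount F n = length (filter (isOrbitRep? F n) (allFin (card F n)))

𝒳card : StructureType → ℕ → ℕ
𝒳card F m = orbitCount F (suc m)

-- The operator 𝒱 (on cardinalities) and its generating series.
-- 𝒱Φ = Σ_k 𝒱Φ_(k); 𝒱Φ_(0) = 𝒱Φ_(1) = (0,0); for k ≥ 2,
-- 𝒱Φ_(k) = (𝒳Φ⁻_(k), 𝒳Φ⁺_(k)) which has degree k-1.  Hence at size m: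
-- (𝒱Φ)⁺_0 = (𝒱Φ)⁻_0 = 0, and for m ≥ 1 (k = m+1 ≥ 2)
-- (𝒱Φ)⁺_m = |𝒳Φ⁻(S)|, (𝒱Φ)⁻_m = |𝒳Φ⁺(S)| with |S| = m.

𝒱card⁺ : IntegralStructureType → ℕ → ℕ
𝒱card⁺ Φ zero    = 0
𝒱card⁺ Φ (suc m) = 𝒳card (neg Φ) (suc m)

𝒱card⁻ : IntegralStructureType → ℕ → ℕ
𝒱card⁻ Φ zero    = 0
𝒱card⁻ Φ (suc m) = 𝒳card (pos Φ) (suc m)

gs𝒱 : IntegralStructureType → ℕ → ℚ
gs𝒱 Φ m = _/_ (+ 𝒱card⁺ Φ m) (m !) {{m !≢0}}
        - _/_ (+ 𝒱card⁻ Φ m) (m !) {{m !≢0}}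

ϑ : (ℕ → ℚ) → ℕ → ℚ
ϑ a zero    = 0ℚ
ϑ a (suc n) = - a (suc (suc n))

-- The cyclic group ℤₙ acts on F(Fin n) through the powers of the n-cycle.
-- For regular F the action is free, so each orbit has exactly n elements and
-- n · |𝒳F(S)| = F_n for |S| = n − 1; we count by double counting the pairs
-- (rotation, structure) whose image is the least element of its orbit.
-- Dividing by n! gives (𝒳F)_{n−1}/(n−1)! = F_n/n!: 𝒳 acts on generating
-- series as d/dz, so 𝒱, which swaps the signs and drops degrees 0 and 1, acts as ϑ.
module Submission where

open import Defs
open import Algebra.Properties.AbelianGroup using (⁻¹-anti-homo‿-)
import Algebra.Properties.CommutativeMonoid.Sum as CommutativeMonoidSum
open import Data.Fin using (Fin; zero; suc; toℕ; fromℕ<)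
open import Data.Fin.Permutation
  using (Permutation′; _⟨$⟩ʳ_; _∘ₚ_; _≈_; permutation; flip; inverseˡ; inverseʳ)
  renaming (id to idₚ)
open import Data.Fin.Properties
  using (toℕ-injective; toℕ-fromℕ<; toℕ<n; toℕ≤pred[n])
  renaming (suc-injective to Fin-suc-injective; 0≢1+n to Fin-0≢1+n)
import Data.Integer as ℤ
import Data.Integer.Properties as ℤ
open import Data.List using (length; filter; tabulate; allFin)
open import Data.List.Extrema.Nat using (argmin; f[argmin]≤f[xs])
open import Data.List.Membership.Propositional.Properties using (∈-allFin)
open import Data.List.Relation.Unary.All using (lookup)
open import Data.Nat as ℕ using (ℕ; zero; suc; _+_; _∸_; _*_; _<_; _!; s≤s; NonZero)
open import Data.Nat.DivMod
  using (_%_; %-distribˡ-+; m%n%n≡m%n; m<n⇒m%n≡m; n%n≡0; [m+n]%n≡m%n; m%n<n)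
open import Data.Nat.Properties
open import Data.Product using (Σ-syntax; _,_; proj₁; proj₂)
open import Data.Rational using (ℚ; _/_; _-_)
open import Data.Rational.Properties using (fromℚᵘ-cong; +-0-abelianGroup)
open import Data.Rational.Unnormalised using (mkℚᵘ; *≡*)
open import Data.Sum using (inj₁; inj₂)
open import Function using (_∘_)
open import Relation.Binary.Definitions using (tri<; tri≈; tri>)
open import Relation.Binary.PropositionalEquality
open import Relation.Nullary using (Dec; yes; no; ¬_; contradiction)
open import Relation.Unary using (Decidable)

open CommutativeMonoidSum +-0-commutativeMonoid using (sum; sum-cong-≗; ∑-comm; sum-permute)

indicator : ∀ {p} {P : Set p} → Dec P → ℕ
indicator (yes _) = 1
indicator (no _)  = 0

count : ∀ {m} {P : Fin m → Set} → Decidable P → ℕ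
count P? = sum (indicator ∘ P?)

length-filter-tabulate : ∀ {A : Set} {P : A → Set} (P? : Decidable P) m (f : Fin m → A) →
                         length (filter P? (tabulate f)) ≡ count (P? ∘ f)
length-filter-tabulate P? zero    f = refl
length-filter-tabulate P? (suc m) f with P? (f zero)
... | yes _ = cong suc (length-filter-tabulate P? m (f ∘ suc))
... | no _  = length-filter-tabulate P? m (f ∘ suc)

count-none : ∀ m {P : Fin m → Set} (P? : Decidable P) → (∀ i → ¬ P i) → count P? ≡ 0
count-none zero    P? ¬P = refl
count-none (suc m) P? ¬P with P? zero
... | yes P0 = contradiction P0 (¬P zero)
... | no _   = count-none m (P? ∘ suc) (¬P ∘ suc)

count-unique : ∀ m {P : Fin m → Set} (P? : Decidable P) i → P i →
               (∀ i j → P i → P j → i ≡ j) → count P? ≡ 1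
count-unique (suc m) P? zero Pi unique with P? zero
... | no ¬P0 = contradiction Pi ¬P0
... | yes _  = cong suc (count-none m (P? ∘ suc) (λ j Pj → Fin-0≢1+n (unique zero (suc j) Pi Pj)))
count-unique (suc m) P? (suc i) Pi unique with P? zero
... | yes P0 = contradiction (unique zero (suc i) P0 Pi) Fin-0≢1+n
... | no _   = count-unique m (P? ∘ suc) i Pi
                 (λ j k Pj Pk → Fin-suc-injective (unique (suc j) (suc k) Pj Pk))

sum-const : ∀ m c → sum {m} (λ _ → c) ≡ m * c
sum-const zero    c = refl
sum-const (suc m) c = cong (c +_) (sum-const m c)

count-transversal : ∀ {n N} (g : Fin n → Permutation′ N) {P : Fin N → Set} (P? : Decidable P) →
                    (∀ x → Σ[ j ∈ Fin n ] P (g j ⟨$⟩ʳ x)) →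
                    (∀ x i j → P (g i ⟨$⟩ʳ x) → P (g j ⟨$⟩ʳ x) → i ≡ j) →
                    n * count P? ≡ N
count-transversal {n} {N} g P? exists unique = begin
  n * count P?                                        ≡⟨ sum-const n (count P?) ⟨
  sum {n} (λ _ → count P?)                            ≡⟨ sum-cong-≗ {n} (λ j → sum-permute _ (g j)) ⟩
  sum {n} (λ j → sum {N} (λ x → pair j x))            ≡⟨ ∑-comm {n} {N} pair ⟩
  sum {N} (λ x → sum {n} (λ j → pair j x))            ≡⟨ sum-cong-≗ {N} unique-j ⟩
  sum {N} (λ _ → 1)                                   ≡⟨ sum-const N 1 ⟩
  N * 1                                               ≡⟨ *-identityʳ N ⟩
  N                                                   ∎
  where
  open ≡-Reasoning
  pair : Fin n → Fin N → ℕ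
  pair j x = indicator (P? (g j ⟨$⟩ʳ x))
  unique-j : ∀ x → sum {n} (λ j → pair j x) ≡ 1
  unique-j x with exists x
  ... | j , Pgx = count-unique n (λ j → P? (g j ⟨$⟩ʳ x)) j Pgx (unique x)

argmin-Fin : ∀ {m} (f : Fin (suc m) → ℕ) → Σ[ i ∈ Fin (suc m) ] ∀ j → f i ℕ.≤ f j
argmin-Fin {m} f = argmin f zero (allFin (suc m)) ,
  λ j → lookup (f[argmin]≤f[xs] {f = f} zero (allFin (suc m))) (∈-allFin j)

[m%d+n]%d≡[m+n]%d : ∀ m n d .{{_ : NonZero d}} → (m % d + n) % d ≡ (m + n) % d
[m%d+n]%d≡[m+n]%d m n d = begin
  (m % d + n) % d          ≡⟨ %-distribˡ-+ (m % d) n d ⟩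
  (m % d % d + n % d) % d  ≡⟨ cong (λ t → (t + n % d) % d) (m%n%n≡m%n m d) ⟩
  (m % d + n % d) % d      ≡⟨ %-distribˡ-+ m n d ⟨
  (m + n) % d              ∎
  where open ≡-Reasoning

[m+n%d]%d≡[m+n]%d : ∀ m n d .{{_ : NonZero d}} → (m + n % d) % d ≡ (m + n) % d
[m+n%d]%d≡[m+n]%d m n d = begin
  (m + n % d) % d  ≡⟨ cong (_% d) (+-comm m (n % d)) ⟩
  (n % d + m) % d  ≡⟨ [m%d+n]%d≡[m+n]%d n m d ⟩
  (n + m) % d      ≡⟨ cong (_% d) (+-comm n m) ⟩
  (m + n) % d      ∎
  where open ≡-Reasoning

toℕ-cyc-< : ∀ k (i : Fin (suc k)) → toℕ i < k → toℕ (cyc (suc k) ⟨$⟩ʳ i) ≡ suc (toℕ i)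
toℕ-cyc-< (suc k) zero    _         = refl
toℕ-cyc-< (suc k) (suc i) (s≤s i<k) with cyc (suc k) ⟨$⟩ʳ i | toℕ-cyc-< k i i<k
... | suc _ | eq = cong suc eq

cyc-last : ∀ k (i : Fin (suc k)) → toℕ i ≡ k → cyc (suc k) ⟨$⟩ʳ i ≡ zero
cyc-last zero    zero    _  = refl
cyc-last (suc k) (suc i) eq with cyc (suc k) ⟨$⟩ʳ i | cyc-last k i (suc-injective eq)
... | zero | _ = refl

toℕ-cyc : ∀ k (i : Fin (suc k)) → toℕ (cyc (suc k) ⟨$⟩ʳ i) ≡ suc (toℕ i) % suc k
toℕ-cyc k i with m≤n⇒m<n∨m≡n (toℕ≤pred[n] i)
... | inj₁ i<k  = trans (toℕ-cyc-< k i i<k) (sym (m<n⇒m%n≡m (s≤s i<k)))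
... | inj₂ i≡k = begin
  toℕ (cyc (suc k) ⟨$⟩ʳ i)  ≡⟨ cong toℕ (cyc-last k i i≡k) ⟩
  0                        ≡⟨ n%n≡0 (suc k) ⟨
  suc k % suc k            ≡⟨ cong (λ t → suc t % suc k) i≡k ⟨
  suc (toℕ i) % suc k      ∎
  where open ≡-Reasoning

toℕ-cyc^ : ∀ k j (i : Fin (suc k)) → toℕ ((cyc (suc k) ^ₚ j) ⟨$⟩ʳ i) ≡ (toℕ i + j) % suc k
toℕ-cyc^ k zero    i = sym (trans (cong (_% suc k) (+-identityʳ (toℕ i))) (m<n⇒m%n≡m (toℕ<n i)))
toℕ-cyc^ k (suc j) i = begin
  toℕ ((cyc n ^ₚ j) ⟨$⟩ʳ (cyc n ⟨$⟩ʳ i))  ≡⟨ toℕ-cyc^ k j (cyc n ⟨$⟩ʳ i) ⟩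
  (toℕ (cyc n ⟨$⟩ʳ i) + j) % n           ≡⟨ cong (λ t → (t + j) % n) (toℕ-cyc k i) ⟩
  (suc (toℕ i) % n + j) % n              ≡⟨ [m%d+n]%d≡[m+n]%d (suc (toℕ i)) j n ⟩
  (suc (toℕ i) + j) % n                  ≡⟨ cong (_% n) (+-suc (toℕ i) j) ⟨
  (toℕ i + suc j) % n                    ∎
  where
  open ≡-Reasoning
  n : ℕ
  n = suc k

cyc^-% : ∀ k j → cyc (suc k) ^ₚ j ≈ cyc (suc k) ^ₚ (j % suc k)
cyc^-% k j i = toℕ-injective (begin
  toℕ ((cyc (suc k) ^ₚ j) ⟨$⟩ʳ i)             ≡⟨ toℕ-cyc^ k j i ⟩
  (toℕ i + j) % suc k                         ≡⟨ [m+n%d]%d≡[m+n]%d (toℕ i) j (suc k) ⟨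
  (toℕ i + j % suc k) % suc k                 ≡⟨ toℕ-cyc^ k (j % suc k) i ⟨
  toℕ ((cyc (suc k) ^ₚ (j % suc k)) ⟨$⟩ʳ i)   ∎)
  where open ≡-Reasoning

module _ (F : StructureType) where

  act-≈id : ∀ {n} {σ : Permutation′ n} → σ ≈ idₚ → ∀ x → act F σ x ≡ x
  act-≈id {σ = σ} σ≈id x = trans (act-cong F σ idₚ σ≈id x) (act-id F x)

  actₚ : ∀ {n} → Permutation′ n → Permutation′ (card F n)
  actₚ σ = permutation (act F σ) (act F (flip σ))
    (λ y → trans (sym (act-∘ F (flip σ) σ y)) (act-≈id (λ _ → inverseʳ σ) y))
    (λ x → trans (sym (act-∘ F σ (flip σ) x)) (act-≈id (λ _ → inverseˡ σ) x))

  act-^ₚ-+ : ∀ {n} (σ : Permutation′ n) a b x →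
             act F (σ ^ₚ (a + b)) x ≡ act F (σ ^ₚ b) (act F (σ ^ₚ a) x)
  act-^ₚ-+ σ zero    b x = cong (act F (σ ^ₚ b)) (sym (act-id F x))
  act-^ₚ-+ σ (suc a) b x = begin
    act F (σ ∘ₚ σ ^ₚ (a + b)) x                  ≡⟨ act-∘ F σ (σ ^ₚ (a + b)) x ⟩
    act F (σ ^ₚ (a + b)) (act F σ x)             ≡⟨ act-^ₚ-+ σ a b (act F σ x) ⟩
    act F (σ ^ₚ b) (act F (σ ^ₚ a) (act F σ x))  ≡⟨ cong (act F (σ ^ₚ b)) (act-∘ F σ (σ ^ₚ a) x) ⟨
    act F (σ ^ₚ b) (act F (σ ∘ₚ σ ^ₚ a) x)       ∎
    where open ≡-Reasoning

module Rotation (F : StructureType) (k : ℕ) where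

  private
    n : ℕ
    n = suc k

  rotate : ℕ → Fin (card F n) → Fin (card F n)
  rotate j = act F (cyc n ^ₚ j)

  rotate-+ : ∀ a b x → rotate (a + b) x ≡ rotate b (rotate a x)
  rotate-+ = act-^ₚ-+ F (cyc n)

  rotate-% : ∀ j x → rotate j x ≡ rotate (j % n) x
  rotate-% j = act-cong F _ _ (cyc^-% k j)

  rotate-fromℕ< : ∀ j x → Σ[ i ∈ Fin n ] rotate j x ≡ rotate (toℕ i) x
  rotate-fromℕ< j x = fromℕ< (m%n<n j n) ,
    trans (rotate-% j x) (cong (λ t → rotate t x) (sym (toℕ-fromℕ< (m%n<n j n))))

  rotate-via : ∀ a b x → a ℕ.≤ n → rotate b x ≡ rotate (n ∸ a + b) (rotate a x)
  rotate-via a b x a≤n = begin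
    rotate b x                  ≡⟨ rotate-% b x ⟩
    rotate (b % n) x            ≡⟨ cong (λ t → rotate t x) ([m+n]%n≡m%n b n) ⟨
    rotate ((b + n) % n) x      ≡⟨ rotate-% (b + n) x ⟨
    rotate (b + n) x            ≡⟨ cong (λ t → rotate t x) b+n≡a+[n∸a+b] ⟩
    rotate (a + (n ∸ a + b)) x  ≡⟨ rotate-+ a (n ∸ a + b) x ⟩
    rotate (n ∸ a + b) (rotate a x) ∎
    where
    open ≡-Reasoning
    b+n≡a+[n∸a+b] : b + n ≡ a + (n ∸ a + b)
    b+n≡a+[n∸a+b] = begin
      b + n              ≡⟨ +-comm b n ⟩
      n + b              ≡⟨ cong (_+ b) (m+[n∸m]≡n a≤n) ⟨
      a + (n ∸ a) + b    ≡⟨ +-assoc a (n ∸ a) b ⟩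
      a + (n ∸ a + b)    ∎

  IsRep : Fin (card F n) → Set
  IsRep = IsOrbitRep F n

  isRep-≤-rotate : ∀ {y} → IsRep y → ∀ j → toℕ y ℕ.≤ toℕ (rotate j y)
  isRep-≤-rotate {y} rep j with rotate-fromℕ< j y
  ... | i , eq = subst (λ z → toℕ y ℕ.≤ toℕ z) (sym eq) (rep i)

  rep-exists : ∀ x → Σ[ i ∈ Fin n ] IsRep (rotate (toℕ i) x)
  rep-exists x = i₀ , minimal
    where
    height : Fin n → ℕ
    height i = toℕ (rotate (toℕ i) x)
    lowest : Σ[ i ∈ Fin n ] ∀ j → height i ℕ.≤ height j
    lowest = argmin-Fin height
    i₀ : Fin n
    i₀ = proj₁ lowest
    minimal : IsRep (rotate (toℕ i₀) x)
    minimal j = subst (λ z → height i₀ ℕ.≤ toℕ z)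
      (trans (sym (proj₂ reduced)) (rotate-+ (toℕ i₀) (toℕ j) x))
      (proj₂ lowest (proj₁ reduced))
      where
      reduced : Σ[ i ∈ Fin n ] rotate (toℕ i₀ + toℕ j) x ≡ rotate (toℕ i) x
      reduced = rotate-fromℕ< (toℕ i₀ + toℕ j) x

  module _ (regular : Regular F) where

    rotate-fixed : ∀ j x → rotate j x ≡ x → j % n ≡ 0
    rotate-fixed j x fixed =
      trans (sym (toℕ-cyc^ k j zero)) (cong toℕ (regular n (cyc n ^ₚ j) x fixed zero))

    rotate-injective-< : ∀ a b x → a < b → b < n → rotate a x ≢ rotate b x
    rotate-injective-< a b x a<b b<n eq = <⇒≢ (m<n⇒0<n∸m a<b) (sym b∸a≡0)
      where
      b∸a-fixes : rotate (b ∸ a) (rotate a x) ≡ rotate a x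
      b∸a-fixes = begin
        rotate (b ∸ a) (rotate a x)  ≡⟨ rotate-+ a (b ∸ a) x ⟨
        rotate (a + (b ∸ a)) x       ≡⟨ cong (λ t → rotate t x) (m+[n∸m]≡n (<⇒≤ a<b)) ⟩
        rotate b x                   ≡⟨ eq ⟨
        rotate a x                   ∎
        where open ≡-Reasoning
      b∸a≡0 : b ∸ a ≡ 0
      b∸a≡0 = trans (sym (m<n⇒m%n≡m (≤-<-trans (m∸n≤m b a) b<n)))
                    (rotate-fixed (b ∸ a) (rotate a x) b∸a-fixes)

    rotate-injective : ∀ (i j : Fin n) x → rotate (toℕ i) x ≡ rotate (toℕ j) x → i ≡ j
    rotate-injective i j x eq with <-cmp (toℕ i) (toℕ j)
    ... | tri< i<j _ _ = contradiction eq (rotate-injective-< _ _ x i<j (toℕ<n j))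
    ... | tri≈ _ i≡j _ = toℕ-injective i≡j
    ... | tri> _ _ j<i = contradiction (sym eq) (rotate-injective-< _ _ x j<i (toℕ<n i))

    rep-unique : ∀ x (i j : Fin n) → IsRep (rotate (toℕ i) x) → IsRep (rotate (toℕ j) x) → i ≡ j
    rep-unique x i j repᵢ repⱼ = rotate-injective i j x
      (toℕ-injective (≤-antisym (≤-every-rotation i j repᵢ) (≤-every-rotation j i repⱼ)))
      where
      ≤-every-rotation : ∀ i j → IsRep (rotate (toℕ i) x) →
                         toℕ (rotate (toℕ i) x) ℕ.≤ toℕ (rotate (toℕ j) x)
      ≤-every-rotation i j rep =
        subst (λ z → toℕ (rotate (toℕ i) x) ℕ.≤ toℕ z)
          (sym (rotate-via (toℕ i) (toℕ j) x (<⇒≤ (toℕ<n i))))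
          (isRep-≤-rotate rep (n ∸ toℕ i + toℕ j))

    orbitCount-regular : n * orbitCount F n ≡ card F n
    orbitCount-regular = trans
      (cong (n *_) (length-filter-tabulate (isOrbitRep? F n) (card F n) (λ x → x)))
      (count-transversal (λ i → actₚ F (rot n i)) (isOrbitRep? F n) rep-exists rep-unique)

*-/-cancelˡ : ∀ c a d .{{_ : NonZero c}} .{{_ : NonZero d}} .{{_ : NonZero (c * d)}} →
              (ℤ.+ (c * a)) / (c * d) ≡ (ℤ.+ a) / d
-- A fraction with non-negative numerator is fromℚᵘ of the unnormalised one,
-- so the cancellation reduces to a cross-multiplication in ℤ.
*-/-cancelˡ (suc c) a (suc d) =
  fromℚᵘ-cong {mkℚᵘ (ℤ.+ (suc c * a)) (d + c * suc d)} {mkℚᵘ (ℤ.+ a) d} (*≡* cross)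
  where
  cross : ℤ.+ (suc c * a) ℤ.* ℤ.+ suc d ≡ ℤ.+ a ℤ.* ℤ.+ (suc c * suc d)
  cross = begin
    ℤ.+ (suc c * a) ℤ.* ℤ.+ suc d  ≡⟨ ℤ.pos-* (suc c * a) (suc d) ⟨
    ℤ.+ (suc c * a * suc d)        ≡⟨ cong (λ t → ℤ.+ (t * suc d)) (*-comm (suc c) a) ⟩
    ℤ.+ (a * suc c * suc d)        ≡⟨ cong ℤ.+_ (*-assoc a (suc c) (suc d)) ⟩
    ℤ.+ (a * (suc c * suc d))      ≡⟨ ℤ.pos-* a (suc c * suc d) ⟩
    ℤ.+ a ℤ.* ℤ.+ (suc c * suc d)  ∎
    where open ≡-Reasoning

gs𝒳 : StructureType → ℕ → ℚ
gs𝒳 F m = _/_ (ℤ.+ 𝒳card F m) (m !) {{m !≢0}}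

gs𝒳≡gs∘suc : ∀ F → Regular F → ∀ m → gs𝒳 F m ≡ gs F (suc m)
gs𝒳≡gs∘suc F regular m = begin
  gs𝒳 F m
    ≡⟨ *-/-cancelˡ (suc m) (𝒳card F m) (m !) {{_}} {{m !≢0}} {{suc m !≢0}} ⟨
  _/_ (ℤ.+ (suc m * orbitCount F (suc m))) (suc m !) {{suc m !≢0}}
    ≡⟨ cong (λ c → _/_ (ℤ.+ c) (suc m !) {{suc m !≢0}}) (Rotation.orbitCount-regular F m regular) ⟩
  gs F (suc m) ∎
  where open ≡-Reasoning

theorem7p1 : (Φ : IntegralStructureType) → RegularI Φ →
    ∀ (n : ℕ) → gs𝒱 Φ n ≡ ϑ (gsI Φ) n
theorem7p1 Φ _ zero = refl
theorem7p1 Φ (regular⁺ , regular⁻) (suc m) = begin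
  gs𝒱 Φ (suc m)
    ≡⟨ cong₂ _-_ (gs𝒳≡gs∘suc (neg Φ) regular⁻ (suc m)) (gs𝒳≡gs∘suc (pos Φ) regular⁺ (suc m)) ⟩
  gs (neg Φ) (suc (suc m)) - gs (pos Φ) (suc (suc m))
    ≡⟨ ⁻¹-anti-homo‿- +-0-abelianGroup (gs (pos Φ) (suc (suc m))) (gs (neg Φ) (suc (suc m))) ⟨
  ϑ (gsI Φ) (suc m) ∎
  where open ≡-Reasoning
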